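{- Let $(I,s)$ be a bin packing instance and $0<\varepsilon<0.1$. Let $T=\{v\in I: s(v)\le\varepsilon\}$ and $B=I\setminus T$. If $s(T)>1$ and $s(B)<2$, then $(1-\varepsilon)\cdot(\#\mathrm{FFD}(I)-1)\le s(I)$.
   Context: A bin packing instance is $(I,s)$ with a finite item set $I$ and sizes $s:I\to[0,1]$; $s(A)=\sum_{v\in A}s(v)$. First-Fit Decreasing (FFD): consider the items in non-increasing order of size; place each item into the first (earliest opened) bin whose current total size plus the item's size is at most $1$, and if no such bin exists open a new bin containing it. $\#\mathrm{FFD}(I)$ denotes the number of bins produced.
   Formalization: The item sizes and the parameter ε are rational rather than real. -}

module Defs where

open import Data.Bool using (Bool; true; false; if_then_else_; not)
open import Data.List using (List; []; _∷_; length; filter; foldl)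
open import Data.Nat using (ℕ)
open import Data.Integer using (+_)
open import Data.Rational using (ℚ; _+_; _≤ᵇ_; _/_; 1ℚ; 0ℚ; _≤_; _<_)
open import Data.Rational.Properties using (_≤?_)
open import Data.Product using (_×_)

-- A bin packing instance is represented by the (finite) list of item sizes,
-- i.e. the multiset {s(v) : v ∈ I}; item identities play no role in FFD's bin count.

size : List ℚ → ℚ
size []       = 0ℚ
size (x ∷ xs) = x + size xs

ℕtoℚ : ℕ → ℚ
ℕtoℚ n = + n / 1

insertDesc : ℚ → List ℚ → List ℚ
insertDesc x []       = x ∷ []
insertDesc x (y ∷ ys) = if y ≤ᵇ x then x ∷ y ∷ ys else y ∷ insertDesc x ys

sortDesc : List ℚ → List ℚ
sortDesc []       = []
sortDesc (x ∷ xs) = insertDesc x (sortDesc xs)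

-- Bins are represented by their current loads, in opening order.
firstFitPlace : List ℚ → ℚ → List ℚ
firstFitPlace []       x = x ∷ []
firstFitPlace (b ∷ bs) x = if (b + x) ≤ᵇ 1ℚ then (b + x) ∷ bs else b ∷ firstFitPlace bs x

firstFit : List ℚ → List ℚ
firstFit = foldl firstFitPlace []

#FFD : List ℚ → ℕ
#FFD xs = length (firstFit (sortDesc xs))

ValidSize : ℚ → Set
ValidSize x = (0ℚ ≤ x) × (x ≤ 1ℚ)

{-# OPTIONS --safe #-}
module Submission where

-- Sorted decreasingly, I is its big items followed by its small ones, so FFD runs First Fit
-- on the big items and then on the small ones.  After the big items no two bins fit together;
-- as their total is below 2 there are at most three bins, and if three, they hold more than 1.
-- If the small items open no new bin this already bounds #FFD - 1 by 1 + s(B) < s(I).  Once a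
-- small item x ≤ ε opens a bin, every earlier bin is fuller than 1 - ε, and from then on every
-- bin but the last stays so, which gives (1 - ε)(#FFD - 1) ≤ s(I).

open import Defs
open import Data.List using (List; filter)
open import Data.List.Relation.Unary.All using (All)
open import Data.Integer using (+_)
open import Data.Rational using (ℚ; _+_; _-_; _*_; _/_; _≤_; _<_; 0ℚ; 1ℚ)
open import Data.Rational.Properties using (_≤?_; _<?_)

open import Data.Bool using (true; false)
import Data.Bool as Bool
open import Data.Unit using (tt)
open import Data.Product using (_×_; _,_; proj₁)
open import Data.Sum using (_⊎_; inj₁; inj₂)
open import Function using (_∘_)
open import Function.Bundles using (mk⇔)
open import Data.Nat using (suc)
import Data.Nat.Coprimality as Coprime
import Data.Integer as ℤ
import Data.Integer.Properties as ℤₚ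
open import Data.Rational using (-_; _≥_; _≤ᵇ_; nonNegative)
open import Data.Rational.Properties
open import Data.Rational.Solver using (module +-*-Solver)
open import Data.List using ([]; _∷_; _++_; _∷ʳ_; length; foldl; foldr)
open import Data.List.Properties
  using (foldl-++; filter-all; filter-none; filter-accept; filter-reject)
open import Data.List.Relation.Unary.All using ([]; _∷_)
import Data.List.Relation.Unary.All as All
open import Data.List.Relation.Unary.All.Properties using (∷ʳ⁺; all-filter; filter⁺)
open import Data.List.Relation.Unary.AllPairs using (AllPairs; []; _∷_)
import Data.List.Relation.Unary.AllPairs.Properties as AllPairs
open import Data.List.Relation.Unary.Linked as Linked using (Linked; [])
open import Data.List.Relation.Unary.Linked.Properties using (Linked⇒All)
open import Data.List.Relation.Binary.Pointwise as Pointwise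
  using (Pointwise; []; _∷_; Pointwise-length; All-resp-Pointwise; AllPairs-resp-Pointwise)
open import Data.List.Relation.Binary.Permutation.Propositional using (_↭_; ↭-sym; ↭⇒↭ₛ)
open import Data.List.Relation.Binary.Permutation.Propositional.Properties
  using (All-resp-↭; filter-↭)
open import Data.List.Relation.Binary.Permutation.Setoid.Properties using (foldr-commMonoid)
open import Relation.Binary.Definitions using (_Respects_; _Respects₂_)
open import Relation.Binary.PropositionalEquality
open import Relation.Binary.Properties.DecTotalOrder ≤-decTotalOrder using (≥-decTotalOrder)
open import Data.List.Sort.InsertionSort ≥-decTotalOrder using (insert; sort)
open import Data.List.Sort.InsertionSort.Properties ≥-decTotalOrder using (sort-↭; sort-↗)
open import Relation.Nullary.Decidable using (yes; no; does-⇔; T?)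
open import Relation.Nullary.Negation using (¬_; contradiction)

open +-*-Solver

p≤p+q : ∀ p {q} → 0ℚ ≤ q → p ≤ p + q
p≤p+q p {q} 0≤q = subst (_≤ p + q) (+-identityʳ p) (+-monoʳ-≤ p 0≤q)

≤⇒≯ : ∀ {p q} → p ≤ q → ¬ (q < p)
≤⇒≯ p≤q q<p = <-irrefl refl (<-≤-trans q<p p≤q)

≤ᵇ≡false⇒> : ∀ {p q} → (p ≤ᵇ q) ≡ false → q < p
≤ᵇ≡false⇒> eq = ≰⇒> (subst Bool.T eq ∘ ≤⇒≤ᵇ)

p*q≤r : ∀ {p q r} → 0ℚ ≤ p → p ≤ 1ℚ → 0ℚ ≤ r → q ≤ r → p * q ≤ r
p*q≤r {p} {q} {r} 0≤p p≤1 0≤r q≤r = begin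
  p * q   ≤⟨ *-monoˡ-≤-nonNeg p {{nonNegative 0≤p}} q≤r ⟩
  p * r   ≤⟨ *-monoʳ-≤-nonNeg r {{nonNegative 0≤r}} p≤1 ⟩
  1ℚ * r  ≡⟨ *-identityˡ r ⟩
  r       ∎
  where open ≤-Reasoning

ℕtoℚ-suc : ∀ n → ℕtoℚ (suc n) ≡ 1ℚ + ℕtoℚ n
-- `+ n / 1` is already in lowest terms, so normalisation leaves it alone.
ℕtoℚ-suc n rewrite normalize-coprime (Coprime.sym (Coprime.1-coprimeTo n)) =
  cong (λ m → (+ 1 ℤ.+ m) / 1) (sym (ℤₚ.*-identityʳ (+ n)))

size-++ : ∀ xs ys → size (xs ++ ys) ≡ size xs + size ys
size-++ []       ys = sym (+-identityˡ (size ys))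
size-++ (x ∷ xs) ys = trans (cong (_+_ x) (size-++ xs ys)) (sym (+-assoc x (size xs) (size ys)))

size≡foldr : ∀ xs → size xs ≡ foldr _+_ 0ℚ xs
size≡foldr []       = refl
size≡foldr (x ∷ xs) = cong (_+_ x) (size≡foldr xs)

size-↭ : ∀ {xs ys} → xs ↭ ys → size xs ≡ size ys
size-↭ {xs} {ys} xs↭ys = begin
  size xs             ≡⟨ size≡foldr xs ⟩
  foldr _+_ 0ℚ xs     ≡⟨ foldr-commMonoid (setoid ℚ) +-0-isCommutativeMonoid (↭⇒↭ₛ xs↭ys) ⟩
  foldr _+_ 0ℚ ys     ≡⟨ size≡foldr ys ⟨
  size ys             ∎
  where open ≡-Reasoning

size-nonNeg : ∀ {xs} → All (0ℚ ≤_) xs → 0ℚ ≤ size xs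
size-nonNeg []       = ≤-refl
size-nonNeg (p ∷ ps) = +-mono-≤ p (size-nonNeg ps)

insertDesc≡insert : ∀ x xs → insertDesc x xs ≡ insert x xs
insertDesc≡insert x []       = refl
insertDesc≡insert x (y ∷ ys)
  rewrite does-⇔ (mk⇔ ≤⇒≤ᵇ ≤ᵇ⇒≤) (y ≤? x) (T? (y ≤ᵇ x)) | insertDesc≡insert x ys = refl

sortDesc≡sort : ∀ xs → sortDesc xs ≡ sort xs
sortDesc≡sort []       = refl
sortDesc≡sort (x ∷ xs) rewrite sortDesc≡sort xs = insertDesc≡insert x (sort xs)

sortDesc-↭ : ∀ xs → sortDesc xs ↭ xs
sortDesc-↭ xs rewrite sortDesc≡sort xs = sort-↭ xs

sortDesc-↘ : ∀ xs → Linked _≥_ (sortDesc xs)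
sortDesc-↘ xs rewrite sortDesc≡sort xs = sort-↗ xs

descending⇒filter-++ : ∀ ε {xs} → Linked _≥_ xs → xs ≡ filter (ε <?_) xs ++ filter (_≤? ε) xs
descending⇒filter-++ ε []                = refl
descending⇒filter-++ ε {x ∷ xs} sorted with x ≤? ε
... | yes x≤ε =
  sym (cong₂ _++_ (filter-none (ε <?_) (All.map ≤⇒≯ small)) (filter-all (_≤? ε) small))
  where
  small : All (_≤ ε) (x ∷ xs)
  small = Linked⇒All (λ y≥z x≥y → ≤-trans x≥y y≥z) x≤ε sorted
... | no x≰ε = begin
  x ∷ xs                                              ≡⟨ cong (x ∷_) (descending⇒filter-++ ε (Linked.tail sorted)) ⟩
  x ∷ filter (ε <?_) xs ++ filter (_≤? ε) xs          ≡⟨ cong₂ _++_ (filter-accept (ε <?_) (≰⇒> x≰ε))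
                                                                     (filter-reject (_≤? ε) x≰ε) ⟨
  filter (ε <?_) (x ∷ xs) ++ filter (_≤? ε) (x ∷ xs)  ∎
  where open ≡-Reasoning

NoFit : ℚ → ℚ → Set
NoFit b x = 1ℚ < b + x

NoFit-resp-≤ : NoFit Respects₂ _≤_
NoFit-resp-≤ = (λ {b} x≤y noFit → <-≤-trans noFit (+-monoʳ-≤ b x≤y))
             , (λ {x} b≤c noFit → <-≤-trans noFit (+-monoˡ-≤ x b≤c))

firstFitPlace-grows-or-opens : ∀ bs {x} → 0ℚ ≤ x →
  Pointwise _≤_ bs (firstFitPlace bs x) ⊎ (firstFitPlace bs x ≡ bs ∷ʳ x × All (λ b → NoFit b x) bs)
firstFitPlace-grows-or-opens []       _   = inj₂ (refl , [])
firstFitPlace-grows-or-opens (b ∷ bs) {x} 0≤x with (b + x) ≤ᵇ 1ℚ in fits?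
... | true  = inj₁ (p≤p+q b 0≤x ∷ Pointwise.refl ≤-refl)
... | false with firstFitPlace-grows-or-opens bs 0≤x
...   | inj₁ grows          = inj₁ (≤-refl ∷ grows)
...   | inj₂ (opens , noFit) = inj₂ (cong (b ∷_) opens , ≤ᵇ≡false⇒> fits? ∷ noFit)

size-firstFitPlace : ∀ bs x → size (firstFitPlace bs x) ≡ size bs + x
size-firstFitPlace []       x = +-comm x 0ℚ
size-firstFitPlace (b ∷ bs) x with (b + x) ≤ᵇ 1ℚ
... | true  = solve 3 (λ b x s → (b :+ x) :+ s := (b :+ s) :+ x) refl b x (size bs)
... | false = trans (cong (_+_ b) (size-firstFitPlace bs x)) (sym (+-assoc b (size bs) x))

foldl-preserves : ∀ {A B : Set} {R : A → Set} (Inv : B → Set) {f : B → A → B} →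
  (∀ {b x} → R x → Inv b → Inv (f b x)) → ∀ {b xs} → All R xs → Inv b → Inv (foldl f b xs)
foldl-preserves Inv step []         inv = inv
foldl-preserves Inv step (rx ∷ rxs) inv = foldl-preserves Inv step rxs (step rx inv)

size-foldl-firstFitPlace : ∀ bs xs → size (foldl firstFitPlace bs xs) ≡ size bs + size xs
size-foldl-firstFitPlace bs []       = sym (+-identityʳ (size bs))
size-foldl-firstFitPlace bs (x ∷ xs) = begin
  size (foldl firstFitPlace (firstFitPlace bs x) xs) ≡⟨ size-foldl-firstFitPlace (firstFitPlace bs x) xs ⟩
  size (firstFitPlace bs x) + size xs                ≡⟨ cong (_+ size xs) (size-firstFitPlace bs x) ⟩
  size bs + x + size xs                              ≡⟨ +-assoc (size bs) x (size xs) ⟩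
  size bs + (x + size xs)                            ∎
  where open ≡-Reasoning

firstFitPlace-nonNeg : ∀ {bs x} → 0ℚ ≤ x → All (0ℚ ≤_) bs → All (0ℚ ≤_) (firstFitPlace bs x)
firstFitPlace-nonNeg {bs} 0≤x nonNeg with firstFitPlace-grows-or-opens bs 0≤x
... | inj₁ grows          = All-resp-Pointwise (λ b≤c 0≤b → ≤-trans 0≤b b≤c) grows nonNeg
... | inj₂ (opens , _)    = subst (All (0ℚ ≤_)) (sym opens) (∷ʳ⁺ nonNeg 0≤x)

firstFitPlace-noFit : ∀ {bs x} → 0ℚ ≤ x → AllPairs NoFit bs → AllPairs NoFit (firstFitPlace bs x)
firstFitPlace-noFit {bs} 0≤x noFits with firstFitPlace-grows-or-opens bs 0≤x
... | inj₁ grows          = AllPairs-resp-Pointwise NoFit-resp-≤ grows noFits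
... | inj₂ (opens , noFit) =
  subst (AllPairs NoFit) (sym opens) (AllPairs.++⁺ noFits ([] ∷ []) (All.map (_∷ []) noFit))

data AllButLast {A : Set} (P : A → Set) : List A → Set where
  []  : AllButLast P []
  [-] : ∀ {x} → AllButLast P (x ∷ [])
  _∷_ : ∀ {x y ys} → P x → AllButLast P (y ∷ ys) → AllButLast P (x ∷ y ∷ ys)

AllButLast-resp-Pointwise : ∀ {A : Set} {P : A → Set} {R : A → A → Set} →
  P Respects R → AllButLast P Respects Pointwise R
AllButLast-resp-Pointwise resp []               []         = []
AllButLast-resp-Pointwise resp (_ ∷ [])         [-]        = [-]
AllButLast-resp-Pointwise resp (x∼y ∷ rest@(_ ∷ _)) (px ∷ pxs) =
  resp x∼y px ∷ AllButLast-resp-Pointwise resp rest pxs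

All⇒AllButLast-∷ʳ : ∀ {A : Set} {P : A → Set} {xs x} → All P xs → AllButLast P (xs ∷ʳ x)
All⇒AllButLast-∷ʳ []                = [-]
All⇒AllButLast-∷ʳ (px ∷ [])         = px ∷ [-]
All⇒AllButLast-∷ʳ (px ∷ pxs@(_ ∷ _)) = px ∷ All⇒AllButLast-∷ʳ pxs

noFit⇒>1-ε : ∀ {ε b x} → x ≤ ε → NoFit b x → 1ℚ - ε < b
noFit⇒>1-ε {ε} {b} x≤ε noFit = begin-strict
  1ℚ - ε      <⟨ +-monoˡ-< (- ε) (<-≤-trans noFit (+-monoʳ-≤ b x≤ε)) ⟩
  b + ε - ε   ≡⟨ solve 2 (λ b ε → b :+ ε :- ε := b) refl b ε ⟩
  b           ∎
  where open ≤-Reasoning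

firstFitPlace-small : ∀ {ε m bs x} → 0ℚ ≤ x → x ≤ ε →
  length bs ≡ m ⊎ AllButLast (1ℚ - ε <_) bs →
  length (firstFitPlace bs x) ≡ m ⊎ AllButLast (1ℚ - ε <_) (firstFitPlace bs x)
firstFitPlace-small {bs = bs} 0≤x x≤ε inv with firstFitPlace-grows-or-opens bs 0≤x | inv
... | inj₁ grows | inj₁ sameLength = inj₁ (trans (sym (Pointwise-length grows)) sameLength)
... | inj₁ grows | inj₂ full       =
  inj₂ (AllButLast-resp-Pointwise (λ b≤c θ<b → <-≤-trans θ<b b≤c) grows full)
... | inj₂ (opens , noFit) | _    =
  inj₂ (subst (AllButLast _) (sym opens) (All⇒AllButLast-∷ʳ (All.map (noFit⇒>1-ε x≤ε) noFit)))

AllButLast⇒bound : ∀ {θ bs} → 0ℚ ≤ θ → AllButLast (θ <_) bs → All (0ℚ ≤_) bs →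
  θ * (ℕtoℚ (length bs) - 1ℚ) ≤ size bs
AllButLast⇒bound {θ} 0≤θ [] [] =
  ≤-trans (*-monoˡ-≤-nonNeg θ {{nonNegative 0≤θ}} (≤ᵇ⇒≤ tt)) (≤-reflexive (*-zeroʳ θ))
AllButLast⇒bound {θ} 0≤θ [-] nonNeg = ≤-trans (≤-reflexive (*-zeroʳ θ)) (size-nonNeg nonNeg)
AllButLast⇒bound {θ} {b ∷ bs} 0≤θ (θ<b ∷ full) (_ ∷ nonNeg) = begin
  θ * (ℕtoℚ (suc (length bs)) - 1ℚ)  ≡⟨ cong (λ n → θ * (n - 1ℚ)) (ℕtoℚ-suc (length bs)) ⟩
  θ * (1ℚ + ℕtoℚ (length bs) - 1ℚ)   ≡⟨ solve 2 (λ θ n → θ :* (con 1ℚ :+ n :- con 1ℚ) := θ :+ θ :* (n :- con 1ℚ))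
                                                refl θ (ℕtoℚ (length bs)) ⟩
  θ + θ * (ℕtoℚ (length bs) - 1ℚ)    ≤⟨ +-mono-≤ (<⇒≤ θ<b) (AllButLast⇒bound 0≤θ full nonNeg) ⟩
  b + size bs                        ∎
  where open ≤-Reasoning

noFit⇒1<size : ∀ {a b cs} → NoFit a b → All (0ℚ ≤_) cs → 1ℚ < size (a ∷ b ∷ cs)
noFit⇒1<size {a} {b} {cs} noFit nonNeg = begin-strict
  1ℚ                ≡⟨ +-identityʳ 1ℚ ⟨
  1ℚ + 0ℚ           <⟨ +-mono-<-≤ noFit (size-nonNeg nonNeg) ⟩
  a + b + size cs   ≡⟨ +-assoc a b (size cs) ⟩
  a + (b + size cs) ∎
  where open ≤-Reasoning

noFit-length-bound : ∀ {bs} → AllPairs NoFit bs → All (0ℚ ≤_) bs → size bs < + 2 / 1 →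
  ℕtoℚ (length bs) - 1ℚ ≤ 1ℚ + size bs
noFit-length-bound {[]}          _ nonNeg _ = ≤-trans (≤ᵇ⇒≤ tt) (p≤p+q 1ℚ (size-nonNeg nonNeg))
noFit-length-bound {_ ∷ []}      _ nonNeg _ = ≤-trans (≤ᵇ⇒≤ tt) (p≤p+q 1ℚ (size-nonNeg nonNeg))
noFit-length-bound {_ ∷ _ ∷ []} _ nonNeg _ = ≤-trans (≤ᵇ⇒≤ tt) (p≤p+q 1ℚ (size-nonNeg nonNeg))
noFit-length-bound {a ∷ b ∷ _ ∷ []} ((ab ∷ _) ∷ _) (_ ∷ _ ∷ nonNeg) _ =
  +-monoʳ-≤ 1ℚ (<⇒≤ (noFit⇒1<size {a} {b} ab nonNeg))
noFit-length-bound {a ∷ b ∷ cs@(c ∷ d ∷ _)} ((ab ∷ _) ∷ _ ∷ (cd ∷ _) ∷ _) (_ ∷ _ ∷ _ ∷ _ ∷ nonNeg) size<2 =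
  contradiction size<2 (<-asym (begin-strict
    + 2 / 1            ≡⟨⟩
    1ℚ + 1ℚ            <⟨ +-mono-< ab (noFit⇒1<size {c} {d} cd nonNeg) ⟩
    a + b + size cs    ≡⟨ +-assoc a b (size cs) ⟩
    a + (b + size cs)  ∎))
  where open ≤-Reasoning

size-firstFit : ∀ xs → size (firstFit xs) ≡ size xs
size-firstFit xs = trans (size-foldl-firstFitPlace [] xs) (+-identityˡ (size xs))

firstFit-bigThenSmall : ∀ {ε} P Q → 0ℚ ≤ ε → ε ≤ 1ℚ →
  All (0ℚ ≤_) P → All (λ x → 0ℚ ≤ x × x ≤ ε) Q → size P < + 2 / 1 → 1ℚ < size Q →
  (1ℚ - ε) * (ℕtoℚ (length (firstFit (P ++ Q))) - 1ℚ) ≤ size P + size Q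
firstFit-bigThenSmall {ε} P Q 0≤ε ε≤1 nonNegP smallQ sizeP<2 1<sizeQ
  rewrite foldl-++ firstFitPlace [] P Q = conclude phase₂
  where
  θ = 1ℚ - ε
  bins₁ = firstFit P
  bins = foldl firstFitPlace bins₁ Q

  0≤θ : 0ℚ ≤ θ
  0≤θ = subst (_≤ θ) (+-inverseʳ ε) (+-monoˡ-≤ (- ε) ε≤1)

  θ≤1 : θ ≤ 1ℚ
  θ≤1 = +-monoʳ-≤ 1ℚ (neg-antimono-≤ 0≤ε)

  nonNegBins₁ : All (0ℚ ≤_) bins₁
  nonNegBins₁ = foldl-preserves (All (0ℚ ≤_)) firstFitPlace-nonNeg nonNegP []

  nonNegBins : All (0ℚ ≤_) bins
  nonNegBins = foldl-preserves (All (0ℚ ≤_)) (firstFitPlace-nonNeg ∘ proj₁) smallQ nonNegBins₁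

  noFitBins₁ : AllPairs NoFit bins₁
  noFitBins₁ = foldl-preserves (AllPairs NoFit) firstFitPlace-noFit nonNegP []

  phase₂ : length bins ≡ length bins₁ ⊎ AllButLast (θ <_) bins
  phase₂ = foldl-preserves (λ bs → length bs ≡ length bins₁ ⊎ AllButLast (θ <_) bs)
             (λ (0≤x , x≤ε) → firstFitPlace-small 0≤x x≤ε) smallQ (inj₁ refl)

  sizeBins₁<2 : size bins₁ < + 2 / 1
  sizeBins₁<2 = subst (_< + 2 / 1) (sym (size-firstFit P)) sizeP<2

  sizeBins : size bins ≡ size P + size Q
  sizeBins = trans (size-foldl-firstFitPlace bins₁ Q) (cong (_+ size Q) (size-firstFit P))

  conclude : length bins ≡ length bins₁ ⊎ AllButLast (θ <_) bins →
             θ * (ℕtoℚ (length bins) - 1ℚ) ≤ size P + size Q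
  conclude (inj₂ full) =
    subst (θ * (ℕtoℚ (length bins) - 1ℚ) ≤_) sizeBins (AllButLast⇒bound 0≤θ full nonNegBins)
  conclude (inj₁ sameLength) =
    p*q≤r 0≤θ θ≤1 (subst (0ℚ ≤_) sizeBins (size-nonNeg nonNegBins)) (begin
      ℕtoℚ (length bins) - 1ℚ   ≡⟨ cong (λ n → ℕtoℚ n - 1ℚ) sameLength ⟩
      ℕtoℚ (length bins₁) - 1ℚ  ≤⟨ noFit-length-bound noFitBins₁ nonNegBins₁ sizeBins₁<2 ⟩
      1ℚ + size bins₁           ≡⟨ cong (_+_ 1ℚ) (size-firstFit P) ⟩
      1ℚ + size P               <⟨ +-monoˡ-< (size P) 1<sizeQ ⟩
      size Q + size P           ≡⟨ +-comm (size Q) (size P) ⟩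
      size P + size Q           ∎)
    where open ≤-Reasoning

lemma11 : (I : List ℚ) → All ValidSize I → (ε : ℚ) → 0ℚ < ε → ε < + 1 / 10 →
    1ℚ < size (filter (_≤? ε) I) →
    size (filter (ε <?_) I) < + 2 / 1 →
    (1ℚ - ε) * (ℕtoℚ (#FFD I) - 1ℚ) ≤ size I
lemma11 I valid ε 0<ε ε<⅒ 1<sizeT sizeB<2 =
  subst₂ (λ n s → (1ℚ - ε) * (ℕtoℚ n - 1ℚ) ≤ s) lengthBins sizeBins
    (firstFit-bigThenSmall B T (<⇒≤ 0<ε) (≤-trans (<⇒≤ ε<⅒) (≤ᵇ⇒≤ tt))
      (filter⁺ (ε <?_) nonNegL) smallItems
      (subst (_< + 2 / 1) (sym (size-↭ (filter-↭ (ε <?_) L↭I))) sizeB<2)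
      (subst (1ℚ <_) (sym (size-↭ (filter-↭ (_≤? ε) L↭I))) 1<sizeT))
  where
  L = sortDesc I
  B = filter (ε <?_) L
  T = filter (_≤? ε) L

  L↭I : L ↭ I
  L↭I = sortDesc-↭ I

  L≡B++T : L ≡ B ++ T
  L≡B++T = descending⇒filter-++ ε (sortDesc-↘ I)

  nonNegL : All (0ℚ ≤_) L
  nonNegL = All-resp-↭ (↭-sym L↭I) (All.map proj₁ valid)

  smallItems : All (λ x → 0ℚ ≤ x × x ≤ ε) T
  smallItems = All.zip (filter⁺ (_≤? ε) nonNegL , all-filter (_≤? ε) L)

  lengthBins : length (firstFit (B ++ T)) ≡ #FFD I
  lengthBins = cong (length ∘ firstFit) (sym L≡B++T)

  sizeBins : size B + size T ≡ size I
  sizeBins = trans (sym (size-++ B T)) (trans (cong size (sym L≡B++T)) (size-↭ L↭I))
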